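{- Let $X$ be a graph with a unique maximum clique $C$. If there exists an edge in $X$ not contained in $C$, and every edge of $X$ has non-empty intersection with $C$, then there is no vertex-transitive graph whose local graph is isomorphic to $X$.
   Context: All graphs are finite and simple. A maximum clique is a clique of largest size. The local graph of a graph $\Gamma$ at a vertex $v$ is the subgraph induced by the neighbours of $v$; a vertex-transitive graph has local graph isomorphic to $X$ if its local graph at some (equivalently every) vertex is isomorphic to $X$. A graph is vertex-transitive if its automorphism group acts transitively on its vertices. -}

module Defs where

open import Data.Nat using (ℕ; _≤_)
open import Data.Bool using (Bool; true; false)
open import Data.Fin using (Fin)
open import Data.Fin.Subset using (Subset; _∈_; ∣_∣)
open import Data.Fin.Permutation using (Permutation′; _⟨$⟩ʳ_)
open import Data.Product using (_×_; ∃; ∃-syntax; Σ)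
open import Data.Sum using (_⊎_)
open import Relation.Binary.PropositionalEquality using (_≡_; _≢_)
open import Relation.Nullary using (¬_)
open import Function.Definitions using (Injective)

record Graph (n : ℕ) : Set where
  field
    adj   : Fin n → Fin n → Bool
    sym   : ∀ x y → adj x y ≡ adj y x
    irref : ∀ x → adj x x ≡ false

open Graph public

Adjacent : ∀ {n} → Graph n → Fin n → Fin n → Set
Adjacent G x y = adj G x y ≡ true

IsClique : ∀ {n} → Graph n → Subset n → Set
IsClique G C = ∀ x y → x ∈ C → y ∈ C → x ≢ y → Adjacent G x y

IsMaximumClique : ∀ {n} → Graph n → Subset n → Set
IsMaximumClique G C = IsClique G C × (∀ D → IsClique G D → ∣ D ∣ ≤ ∣ C ∣)

IsUniqueMaximumClique : ∀ {n} → Graph n → Subset n → Set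
IsUniqueMaximumClique G C = IsMaximumClique G C × (∀ D → IsMaximumClique G D → D ≡ C)

IsAutomorphism : ∀ {m} → Graph m → Permutation′ m → Set
IsAutomorphism G σ = ∀ x y → adj G (σ ⟨$⟩ʳ x) (σ ⟨$⟩ʳ y) ≡ adj G x y

VertexTransitive : ∀ {m} → Graph m → Set
VertexTransitive G = ∀ v w → ∃[ σ ] (IsAutomorphism G σ × σ ⟨$⟩ʳ v ≡ w)

-- The local graph of Γ at v (subgraph induced on the neighbours of v) is
-- isomorphic to X : an injective map g from V(X) into V(Γ) whose image is
-- exactly the neighbourhood of v and which preserves and reflects adjacency.
LocalGraphIso : ∀ {m n} → Graph m → Fin m → Graph n → Set
LocalGraphIso {m} {n} Γ v X =
  Σ (Fin n → Fin m) λ g →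
    Injective _≡_ _≡_ g
    × (∀ x → Adjacent Γ v (g x))
    × (∀ w → Adjacent Γ v w → ∃[ x ] g x ≡ w)
    × (∀ x y → adj X x y ≡ adj Γ (g x) (g y))

-- Γ has local graph isomorphic to X (at some, equivalently every, vertex).
HasLocalGraph : ∀ {m n} → Graph m → Graph n → Set
HasLocalGraph Γ X = ∃[ v ] LocalGraphIso Γ v X

-- An
-- embedding g of X onto the neighbourhood of a vertex z yields the clique
-- K = {z} ∪ g(C) of Γ, of size ∣C∣ + 1. For any t ∈ K, the local graph at t
-- contains K minus t, a clique of size ∣C∣, whose preimage is therefore a
-- maximum clique of X, hence C itself. So two such cliques sharing a vertex t
-- agree on the neighbourhood of t, and hence coincide. Now take an edge xy of
-- X with x ∈ C and y ∉ C, embedded at z as g x ~ g y = w. Viewed from w, the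
-- edge z (g x) of Γ pulls back to an edge of X, which meets C; so one of z,
-- g x lies in the clique at w as well as in the clique at z. Then these
-- cliques coincide, but w belongs to the first and not to the second.
module Submission where

open import Defs hiding (sym)
open import Data.Nat using (ℕ; _≤_; s≤s; z≤n)
open import Data.Nat.Properties using (≤-trans)
open import Data.Bool using (true)
open import Data.Fin using (Fin; zero; suc; _≟_)
open import Data.Fin.Properties using (any?; suc-injective)
open import Data.Fin.Subset using (Subset; _∈_; _∉_; ∣_∣; inside; outside; _-_)
open import Data.Fin.Subset.Properties using (_∈?_; x∈p∧x≢y⇒x∈p-y; x∈p⇒∣p-x∣<∣p∣)
open import Data.Fin.Permutation using (_⟨$⟩ʳ_; _⟨$⟩ˡ_; inverseʳ)
open import Data.Vec using (_∷_; []; tabulate; here; there)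
open import Data.Vec.Properties using (lookup⇒[]=; []=⇒lookup; lookup∘tabulate)
open import Data.Bool.Properties using (T-≡)
open import Data.Product using (_×_; ∃-syntax; _,_; proj₁; proj₂)
open import Data.Sum using (_⊎_; inj₁; inj₂)
open import Data.Empty using (⊥)
open import Function using (_∘_; Injection; Equivalence)
open import Function.Properties.Inverse using (Inverse⇒Injection)
open import Function.Definitions using (Injective)
open import Relation.Nullary using (¬_; yes; no; does; contradiction)
open import Relation.Nullary.Decidable using (_×-dec_; _⊎-dec_; dec-true; toWitness; isYes≗does)
open import Level using (0ℓ)
open import Relation.Unary using (Pred; Decidable)
open import Relation.Binary.PropositionalEquality
  using (_≡_; _≢_; refl; sym; trans; cong; subst; subst₂)

module _ {n} {P : Pred (Fin n) 0ℓ} (P? : Decidable P) where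

  subset : Subset n
  subset = tabulate (does ∘ P?)

  ∈-subset⁺ : ∀ {x} → P x → x ∈ subset
  ∈-subset⁺ {x} px = lookup⇒[]= x subset (trans (lookup∘tabulate _ x) (dec-true (P? x) px))

  ∈-subset⁻ : ∀ {x} → x ∈ subset → P x
  ∈-subset⁻ {x} x∈s =
    toWitness {a? = P? x} (Equivalence.from T-≡
      (trans (isYes≗does (P? x)) (trans (sym (lookup∘tabulate _ x)) ([]=⇒lookup x∈s))))

injection⇒∣p∣≤∣q∣ : ∀ {n n′} (p : Subset n) (q : Subset n′) (f : ∀ x → x ∈ p → Fin n′) →
  (∀ x x∈p → f x x∈p ∈ q) → (∀ x y x∈p y∈p → f x x∈p ≡ f y y∈p → x ≡ y) → ∣ p ∣ ≤ ∣ q ∣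
injection⇒∣p∣≤∣q∣ [] q f f∈q f-inj = z≤n
injection⇒∣p∣≤∣q∣ (outside ∷ p) q f f∈q f-inj =
  injection⇒∣p∣≤∣q∣ p q (λ x x∈p → f (suc x) (there x∈p)) (λ x x∈p → f∈q (suc x) (there x∈p))
    (λ x y x∈p y∈p eq → suc-injective (f-inj (suc x) (suc y) (there x∈p) (there y∈p) eq))
injection⇒∣p∣≤∣q∣ (inside ∷ p) q f f∈q f-inj =
  ≤-trans (s≤s ∣p∣≤∣q-f₀∣) (x∈p⇒∣p-x∣<∣p∣ (f∈q zero here))
  where
  ∣p∣≤∣q-f₀∣ : ∣ p ∣ ≤ ∣ q - f zero here ∣
  ∣p∣≤∣q-f₀∣ = injection⇒∣p∣≤∣q∣ p (q - f zero here) (λ x x∈p → f (suc x) (there x∈p))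
    (λ x x∈p → x∈p∧x≢y⇒x∈p-y (f∈q (suc x) (there x∈p))
       (λ eq → 0≢suc (f-inj zero (suc x) here (there x∈p) (sym eq))))
    (λ x y x∈p y∈p eq → suc-injective (f-inj (suc x) (suc y) (there x∈p) (there y∈p) eq))
    where
    0≢suc : ∀ {k} {x : Fin k} → zero ≢ suc x
    0≢suc ()

module _ {m} (Γ : Graph m) where

  adjacent-sym : ∀ {x y} → Adjacent Γ x y → Adjacent Γ y x
  adjacent-sym {x} {y} = trans (Graph.sym Γ y x)

  adjacent⇒≢ : ∀ {x y} → Adjacent Γ x y → x ≢ y
  adjacent⇒≢ {x} x~x refl with () ← trans (sym x~x) (irref Γ x)

module _ {m n} {Γ : Graph m} {X : Graph n} where

  localGraphIso-transport : ∀ {σ v} → IsAutomorphism Γ σ →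
    LocalGraphIso Γ v X → LocalGraphIso Γ (σ ⟨$⟩ʳ v) X
  localGraphIso-transport {σ} {v} σ-aut (g , g-inj , g-adj , g-onto , g-iso) =
    (σ ⟨$⟩ʳ_) ∘ g , g-inj ∘ Injection.injective (Inverse⇒Injection σ) , σg-adj , σg-onto , σg-iso
    where
    σg-adj : ∀ x → Adjacent Γ (σ ⟨$⟩ʳ v) (σ ⟨$⟩ʳ g x)
    σg-adj x = trans (σ-aut v (g x)) (g-adj x)

    pull-back : ∀ {w} → Adjacent Γ (σ ⟨$⟩ʳ v) w → Adjacent Γ v (σ ⟨$⟩ˡ w)
    pull-back {w} σv~w = trans (sym (σ-aut v (σ ⟨$⟩ˡ w)))
      (subst (λ w′ → adj Γ (σ ⟨$⟩ʳ v) w′ ≡ true) (sym (inverseʳ σ)) σv~w)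

    σg-onto : ∀ w → Adjacent Γ (σ ⟨$⟩ʳ v) w → ∃[ x ] σ ⟨$⟩ʳ g x ≡ w
    σg-onto w σv~w with x , gx≡σ⁻¹w ← g-onto (σ ⟨$⟩ˡ w) (pull-back σv~w) =
      x , trans (cong (σ ⟨$⟩ʳ_) gx≡σ⁻¹w) (inverseʳ σ)

    σg-iso : ∀ x y → adj X x y ≡ adj Γ (σ ⟨$⟩ʳ g x) (σ ⟨$⟩ʳ g y)
    σg-iso x y = trans (g-iso x y) (sym (σ-aut (g x) (g y)))

  localGraphIso-everywhere : VertexTransitive Γ → HasLocalGraph Γ X → ∀ z → LocalGraphIso Γ z X
  localGraphIso-everywhere vt (v , L) z with σ , σ-aut , σv≡z ← vt v z =
    subst (λ z → LocalGraphIso Γ z X) σv≡z (localGraphIso-transport {σ} σ-aut L)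

module _ {n m : ℕ} (C : Subset n) where

  Cone : Fin m → (Fin n → Fin m) → Pred (Fin m) 0ℓ
  Cone z g t = t ≡ z ⊎ ∃[ c ] (c ∈ C × g c ≡ t)

  cone? : ∀ z g → Decidable (Cone z g)
  cone? z g t = (t ≟ z) ⊎-dec any? (λ c → (c ∈? C) ×-dec (g c ≟ t))

  cone-clique : ∀ {X : Graph n} {Γ : Graph m} {z} → IsClique X C → (L : LocalGraphIso Γ z X) →
    ∀ {t t′} → Cone z (proj₁ L) t → Cone z (proj₁ L) t′ → t ≢ t′ → Adjacent Γ t t′
  cone-clique _ _ (inj₁ refl) (inj₁ refl) z≢z = contradiction refl z≢z
  cone-clique _ (_ , _ , g-adj , _) (inj₁ refl) (inj₂ (c , _ , refl)) _ = g-adj c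
  cone-clique {Γ = Γ} _ (_ , _ , g-adj , _) (inj₂ (c , _ , refl)) (inj₁ refl) _ =
    adjacent-sym Γ (g-adj c)
  cone-clique C-clique (g , _ , _ , _ , g-iso)
    (inj₂ (c , c∈C , refl)) (inj₂ (c′ , c′∈C , refl)) gc≢gc′ =
    trans (sym (g-iso c c′)) (C-clique c c′ c∈C c′∈C (gc≢gc′ ∘ cong g))

  -- g with the value t (if attained) moved to the apex z: a bijection from C onto Cone z g minus t.
  exchange : Fin m → Fin m → (Fin n → Fin m) → Fin n → Fin m
  exchange z t g c with g c ≟ t
  ... | yes _ = z
  ... | no _ = g c

  module _ {z t : Fin m} {g : Fin n → Fin m} (g≢z : ∀ c → g c ≢ z) where

    exchange-injective : Injective _≡_ _≡_ g → Injective _≡_ _≡_ (exchange z t g)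
    exchange-injective g-inj {c} {c′} eq with g c ≟ t | g c′ ≟ t
    ... | yes gc≡t | yes gc′≡t = g-inj (trans gc≡t (sym gc′≡t))
    ... | yes _ | no _ = contradiction (sym eq) (g≢z c′)
    ... | no _ | yes _ = contradiction eq (g≢z c)
    ... | no _ | no _ = g-inj eq

    exchange-≢ : ∀ c → exchange z t g c ≢ t
    exchange-≢ c with g c ≟ t
    ... | yes gc≡t = λ z≡t → g≢z c (trans gc≡t (sym z≡t))
    ... | no gc≢t = gc≢t

  exchange-∈cone : ∀ {z t g c} → c ∈ C → Cone z g (exchange z t g c)
  exchange-∈cone {z} {t} {g} {c} c∈C with g c ≟ t
  ... | yes _ = inj₁ refl
  ... | no _ = inj₂ (c , c∈C , refl)

module _ {n m} {X : Graph n} {Γ : Graph m} {C : Subset n}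
         (C-unique : IsUniqueMaximumClique X C) where

  private
    C-clique = proj₁ (proj₁ C-unique)
    C-maximum = proj₂ (proj₁ C-unique)

  cone-preimage≡C : ∀ {z t} (L : LocalGraphIso Γ z X) → Cone C z (proj₁ L) t →
    (P : LocalGraphIso Γ t X) → subset (cone? C z (proj₁ L) ∘ proj₁ P) ≡ C
  cone-preimage≡C {z} {t} L@(g , g-inj , g-adj , _) t∈K (p , p-inj , _ , p-onto , p-iso) =
    proj₂ C-unique D (D-clique , λ D′ D′-clique → ≤-trans (C-maximum D′ D′-clique) ∣C∣≤∣D∣)
    where
    D? : Decidable (Cone C z g ∘ p)
    D? = cone? C z g ∘ p

    D : Subset n
    D = subset D?

    D-clique : IsClique X D
    D-clique e e′ e∈D e′∈D e≢e′ = trans (p-iso e e′)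
      (cone-clique C {X} {Γ} C-clique L (∈-subset⁻ D? e∈D) (∈-subset⁻ D? e′∈D) (e≢e′ ∘ p-inj))

    g≢z : ∀ c → g c ≢ z
    g≢z c gc≡z = adjacent⇒≢ Γ (g-adj c) (sym gc≡z)

    t~exchange : ∀ {c} → c ∈ C → Adjacent Γ t (exchange C z t g c)
    t~exchange c∈C =
      cone-clique C {X} {Γ} C-clique L t∈K (exchange-∈cone C c∈C) (exchange-≢ C g≢z _ ∘ sym)

    f : ∀ c → c ∈ C → Fin n
    f c c∈C = proj₁ (p-onto _ (t~exchange c∈C))

    pf≡exchange : ∀ c c∈C → p (f c c∈C) ≡ exchange C z t g c
    pf≡exchange c c∈C = proj₂ (p-onto _ (t~exchange c∈C))

    ∣C∣≤∣D∣ : ∣ C ∣ ≤ ∣ D ∣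
    ∣C∣≤∣D∣ = injection⇒∣p∣≤∣q∣ C D f
      (λ c c∈C → ∈-subset⁺ D? (subst (Cone C z g) (sym (pf≡exchange c c∈C)) (exchange-∈cone C c∈C)))
      (λ c c′ c∈C c′∈C eq → exchange-injective C {t = t} g≢z g-inj
        (trans (sym (pf≡exchange c c∈C)) (trans (cong p eq) (pf≡exchange c′ c′∈C))))

  cone-transfer : ∀ {z z′ t s} (L : LocalGraphIso Γ z X) (L′ : LocalGraphIso Γ z′ X) →
    Cone C z (proj₁ L) t → Cone C z′ (proj₁ L′) t → LocalGraphIso Γ t X →
    Adjacent Γ t s → Cone C z (proj₁ L) s → Cone C z′ (proj₁ L′) s
  cone-transfer {z} {z′} L L′ t∈K t∈K′ P@(p , _ , _ , p-onto , _) t~s s∈K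
    with e , pe≡s ← p-onto _ t~s = subst (Cone C z′ (proj₁ L′)) pe≡s pe∈K′
    where
    e∈C : e ∈ C
    e∈C = subst (e ∈_) (cone-preimage≡C L t∈K P)
      (∈-subset⁺ (cone? C z (proj₁ L) ∘ p) (subst (Cone C z (proj₁ L)) (sym pe≡s) s∈K))

    pe∈K′ : Cone C z′ (proj₁ L′) (p e)
    pe∈K′ = ∈-subset⁻ (cone? C z′ (proj₁ L′) ∘ p)
      (subst (e ∈_) (sym (cone-preimage≡C L′ t∈K′ P)) e∈C)

  no-edge-leaving-C : (∀ z → LocalGraphIso Γ z X) → Fin m →
    (∀ x y → Adjacent X x y → x ∈ C ⊎ y ∈ C) → ∀ {x y} → x ∈ C → y ∉ C → ¬ Adjacent X x y
  no-edge-leaving-C local v cover {x} {y} x∈C y∉C x~y with local v | local (proj₁ (local v) y)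
  ... | L@(g , g-inj , g-adj , _ , g-iso) | Lw@(h , _ , _ , h-onto , h-iso) = cases (cover a b a~b)
    where
    w = g y

    gx~w : Adjacent Γ (g x) w
    gx~w = trans (sym (g-iso x y)) x~y

    a b : Fin n
    a = proj₁ (h-onto (g x) (adjacent-sym Γ gx~w))
    b = proj₁ (h-onto v (adjacent-sym Γ (g-adj y)))

    a~b : Adjacent X a b
    a~b = trans (h-iso a b) (subst₂ (Adjacent Γ)
      (sym (proj₂ (h-onto _ _))) (sym (proj₂ (h-onto _ _))) (adjacent-sym Γ (g-adj x)))

    w∉K : ¬ Cone C v g w
    w∉K (inj₁ w≡v) = adjacent⇒≢ Γ (g-adj y) (sym w≡v)
    w∉K (inj₂ (c , c∈C , gc≡w)) = y∉C (subst (_∈ C) (g-inj gc≡w) c∈C)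

    shared : ∀ {t} → Cone C w h t → Cone C v g t → Adjacent Γ t w → ⊥
    shared t∈Kw t∈K t~w = w∉K (cone-transfer Lw L t∈Kw t∈K (local _) t~w (inj₁ refl))

    cases : a ∈ C ⊎ b ∈ C → ⊥
    cases (inj₁ a∈C) = shared (inj₂ (a , a∈C , proj₂ (h-onto _ _))) (inj₂ (x , x∈C , refl)) gx~w
    cases (inj₂ b∈C) = shared (inj₂ (b , b∈C , proj₂ (h-onto _ _))) (inj₁ refl) (g-adj y)

lemma5p10 : ∀ {n} (X : Graph n) (C : Subset n) →
    IsUniqueMaximumClique X C →
    (∃[ x ] ∃[ y ] (Adjacent X x y × ¬ (x ∈ C × y ∈ C))) →
    (∀ x y → Adjacent X x y → x ∈ C ⊎ y ∈ C) →
    ∀ (m : ℕ) (Γ : Graph m) → VertexTransitive Γ → ¬ HasLocalGraph Γ X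
lemma5p10 X C C-unique (x , y , x~y , ¬x,y∈C) cover m Γ vt (v , L) = orient (cover x y x~y)
  where
  local : ∀ z → LocalGraphIso Γ z X
  local = localGraphIso-everywhere {Γ = Γ} {X = X} vt (v , L)

  orient : x ∈ C ⊎ y ∈ C → ⊥
  orient (inj₁ x∈C) =
    no-edge-leaving-C {X = X} {Γ = Γ} C-unique local v cover x∈C (λ y∈C → ¬x,y∈C (x∈C , y∈C)) x~y
  orient (inj₂ y∈C) =
    no-edge-leaving-C {X = X} {Γ = Γ} C-unique local v cover y∈C (λ x∈C → ¬x,y∈C (x∈C , y∈C))
      (adjacent-sym X x~y)
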